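{- Let $T=(S,A,B)$ be a generalized split triad and let $H$ be an arbitrary graph (with at least one vertex), and suppose $V(S)\neq\emptyset$. Then the graph $G=T\circ H$ is $P_4$-disconnected.
   Context: Graphs are finite and simple. A triad is a triple $(S,A,B)$ where $S$ is a graph and $(A,B)$ is an ordered partition of $V(S)$ into two disjoint (possibly empty) sets. A set $M\subseteq V(G)$ is a module of $G$ if every vertex outside $M$ is adjacent either to all or to none of the vertices of $M$. A triad $(S,A,B)$ is a generalized split triad if every connected component of the complement $\overline{S[A]}$ and every connected component of $S[B]$ is a module of $S$. For a triad $T=(S,A,B)$ and a graph $H$, $T\circ H$ denotes the graph on vertex set $A\cup B\cup C$ (disjoint union) whose induced subgraph on $A\cup B$ is $S$, whose induced subgraph on $C$ is a copy of $H$, every vertex of $A$ is adjacent to every vertex of $C$, and no vertex of $B$ is adjacent to any vertex of $C$. A graph $G$ is $P_4$-connected if for every partition of $V(G)$ into two nonempty disjoint sets there is an induced $P_4$ containing vertices of both parts; otherwise it is $P_4$-disconnected. -}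

module Defs where

open import Data.Nat using (ℕ; _+_)
open import Data.Fin using (Fin; splitAt)
open import Data.Bool using (Bool; true; false; not)
open import Data.Sum using (_⊎_; inj₁; inj₂)
open import Data.Product using (Σ; ∃; _×_; _,_)
open import Relation.Binary.PropositionalEquality using (_≡_; _≢_)
open import Relation.Nullary using (¬_)

record Graph : Set where
  field
    n      : ℕ
    adj    : Fin n → Fin n → Bool
    sym    : ∀ u v → adj u v ≡ adj v u
    irrefl : ∀ u → adj u u ≡ false
open Graph public

-- A triad (S, A, B): the ordered partition (A, B) of V(S) is given by
-- inA : V(S) → Bool (inA v ≡ true means v ∈ A, otherwise v ∈ B).
record Triad : Set where
  field
    S   : Graph
    inA : Fin (n S) → Bool
open Triad public

IsModule : {k : ℕ} → (Fin k → Fin k → Bool) → (Fin k → Set) → Set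
IsModule {k} a M = ∀ (z : Fin k) → ¬ M z → ∀ y₁ y₂ → M y₁ → M y₂ → a z y₁ ≡ a z y₂

data Reach {k : ℕ} (P : Fin k → Bool) (E : Fin k → Fin k → Set) (u : Fin k) : Fin k → Set where
  here : P u ≡ true → Reach P E u u
  step : ∀ {v w} → Reach P E u v → P w ≡ true → E v w → Reach P E u w

coEdge : (G : Graph) → Fin (n G) → Fin (n G) → Set
coEdge G u v = (u ≢ v) × (adj G u v ≡ false)

edge : (G : Graph) → Fin (n G) → Fin (n G) → Set
edge G u v = adj G u v ≡ true

-- Every connected component of the complement of S[A] and every connected
-- component of S[B] is a module of S.  The component containing u (u in the
-- relevant part) is the set of vertices reachable from u.
IsGeneralizedSplitTriad : Triad → Set
IsGeneralizedSplitTriad T =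
  (∀ u → inA T u ≡ true → IsModule (adj (S T)) (Reach (inA T) (coEdge (S T)) u))
  × (∀ u → inA T u ≡ false → IsModule (adj (S T)) (Reach (λ v → not (inA T v)) (edge (S T)) u))

-- Adjacency of T ∘ H on Fin (n S + n H): first n S vertices are S, the rest are C (copy of H).
composeAdj : (T : Triad) (H : Graph) → Fin (n (S T) + n H) → Fin (n (S T) + n H) → Bool
composeAdj T H x y with splitAt (n (S T)) x | splitAt (n (S T)) y
... | inj₁ a | inj₁ b = adj (S T) a b
... | inj₂ c | inj₂ d = adj H c d
... | inj₁ a | inj₂ _ = inA T a
... | inj₂ _ | inj₁ a = inA T a

IsInducedP4 : {k : ℕ} → (Fin k → Fin k → Bool) → Fin k → Fin k → Fin k → Fin k → Set
IsInducedP4 ad a b c d =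
  (a ≢ b) × (a ≢ c) × (a ≢ d) × (b ≢ c) × (b ≢ d) × (c ≢ d)
  × (ad a b ≡ true) × (ad b c ≡ true) × (ad c d ≡ true)
  × (ad a c ≡ false) × (ad b d ≡ false) × (ad a d ≡ false)

P4Connected : {k : ℕ} → (Fin k → Fin k → Bool) → Set
P4Connected {k} ad =
  ∀ (X : Fin k → Bool) → (∃ λ x → X x ≡ true) → (∃ λ y → X y ≡ false) →
  Σ (Fin k) λ a → Σ (Fin k) λ b → Σ (Fin k) λ c → Σ (Fin k) λ d →
    IsInducedP4 ad a b c d
    × (X a ≡ true ⊎ X b ≡ true ⊎ X c ≡ true ⊎ X d ≡ true)
    × (X a ≡ false ⊎ X b ≡ false ⊎ X c ≡ false ⊎ X d ≡ false)

P4Disconnected : {k : ℕ} → (Fin k → Fin k → Bool) → Set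
P4Disconnected ad = ¬ P4Connected ad

module Submission where

-- We show that no induced P₄ of G meets both C and V(S);
-- since C and V(S) are both nonempty, the partition (C, V(S)) witnesses that
-- G is P₄-disconnected.
--
-- Then, for a generalized split triad,
-- vertices of A cannot distinguish the ends of an edge of S[B], and vertices
-- of B cannot distinguish the ends of a non-edge of S[A] (both ends lie in one
-- module component).  In G the set C is a module; as every pair of vertices
-- of P₄ is distinguished by a third one, an induced P₄ crossing C meets it in
-- exactly one vertex.  That vertex is adjacent precisely to the P₄-vertices in
-- A, and the two triad facts rule out it being an endpoint or an inner vertex.

open import Defs hiding (sym)
open import Data.Nat using (ℕ; _+_; _≥_)
open import Data.Fin using (Fin; splitAt; _↑ˡ_; _↑ʳ_; fromℕ<)
open import Data.Fin.Properties using (splitAt-↑ˡ; splitAt-↑ʳ; splitAt⁻¹-↑ˡ; splitAt⁻¹-↑ʳ)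
open import Data.Bool using (Bool; true; false; not)
open import Data.Bool.Properties using (not-¬; ¬-not)
open import Data.Sum using (_⊎_; inj₁; inj₂; [_,_])
open import Data.Product using (Σ; _,_; proj₁; proj₂)
open import Data.Empty using (⊥)
open import Relation.Binary.PropositionalEquality using (_≡_; _≢_; refl; sym; trans; cong; ≢-sym)
open import Relation.Nullary using (¬_; contradiction)

noneDiffers : ∀ {b : Bool} → ¬ (b ≡ not b ⊎ b ≡ not b ⊎ b ≡ not b ⊎ b ≡ not b)
noneDiffers = [ differs , [ differs , [ differs , differs ] ] ]
  where
  differs : ∀ {b} → b ≢ not b
  differs = not-¬ refl

module _ {k : ℕ} {ad : Fin k → Fin k → Bool} where

  flipAdj : (∀ x y → ad x y ≡ ad y x) → ∀ {x y b} → ad x y ≡ b → ad y x ≡ b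
  flipAdj ad-sym {x} {y} = trans (ad-sym y x)

  reverseP4 : (∀ x y → ad x y ≡ ad y x) → ∀ {a b c d} →
    IsInducedP4 ad a b c d → IsInducedP4 ad d c b a
  reverseP4 ad-sym (a≢b , a≢c , a≢d , b≢c , b≢d , c≢d , ab , bc , cd , ac , bd , a-d) =
    ( ≢-sym c≢d , ≢-sym b≢d , ≢-sym a≢d , ≢-sym b≢c , ≢-sym a≢c , ≢-sym a≢b
    , flip cd , flip bc , flip ab , flip bd , flip ac , flip a-d )
    where
    flip : ∀ {x y b} → ad x y ≡ b → ad y x ≡ b
    flip = flipAdj ad-sym

  moduleNotSplit : (X : Fin k → Bool) → IsModule ad (λ v → X v ≡ true) →
    ∀ {z x y} → X z ≡ false → X x ≡ true → X y ≡ true →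
    ad z x ≡ true → ad z y ≡ false → ⊥
  moduleNotSplit X isModule {z} {x} {y} zOut xIn yIn zx zy =
    contradiction (trans (sym zx) (trans (isModule z (not-¬ zOut) x y xIn yIn) zy)) λ ()

reachInside : ∀ {k} {P : Fin k → Bool} {E u w} → Reach P E u w → P w ≡ true
reachInside (here p)     = p
reachInside (step _ p _) = p

module _ (T : Triad) (split : IsGeneralizedSplitTriad T) where

  -- The ends of an edge of S[B] lie in one component of S[B], which is a
  -- module; a vertex of A lies outside it and sees both ends alike.
  B-edgeUnsplit : ∀ {u v w} → inA T u ≡ false → inA T v ≡ false →
    adj (S T) u v ≡ true → inA T w ≡ true → adj (S T) w u ≡ adj (S T) w v
  B-edgeUnsplit {u} {v} {w} uB vB uv wA =
    proj₂ split u uB w wOutside u v (here (cong not uB)) (step (here (cong not uB)) (cong not vB) uv)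
    where
    wOutside : ¬ Reach (λ x → not (inA T x)) (edge (S T)) u w
    wOutside r = contradiction (trans (sym (cong not wA)) (reachInside r)) λ ()

  -- The ends of a non-edge of S[A] are adjacent in the complement of S[A], so
  -- lie in one of its components, which is a module; a vertex of B sees both alike.
  A-nonEdgeUnsplit : ∀ {u v w} → inA T u ≡ true → inA T v ≡ true → u ≢ v →
    adj (S T) u v ≡ false → inA T w ≡ false → adj (S T) w u ≡ adj (S T) w v
  A-nonEdgeUnsplit {u} {v} {w} uA vA u≢v uv wB =
    proj₁ split u uA w wOutside u v (here uA) (step (here uA) vA (u≢v , uv))
    where
    wOutside : ¬ Reach (inA T) (coEdge (S T)) u w
    wOutside r = contradiction (trans (sym wB) (reachInside r)) λ ()

module _ (T : Triad) (H : Graph) where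
  private
    nS nH : ℕ
    nS = n (S T)
    nH = n H
    ad : Fin (nS + nH) → Fin (nS + nH) → Bool
    ad = composeAdj T H

  isC : Fin (nS + nH) → Bool
  isC x with splitAt nS x
  ... | inj₁ _ = false
  ... | inj₂ _ = true

  isC-↑ˡ : ∀ a → isC (a ↑ˡ nH) ≡ false
  isC-↑ˡ a rewrite splitAt-↑ˡ nS a nH = refl

  isC-↑ʳ : ∀ h → isC (nS ↑ʳ h) ≡ true
  isC-↑ʳ h rewrite splitAt-↑ʳ nS nH h = refl

  fromS : ∀ {x} → isC x ≡ false → Σ (Fin nS) λ a → a ↑ˡ nH ≡ x
  fromS {x} xS with splitAt nS x in eq
  ... | inj₁ a = a , splitAt⁻¹-↑ˡ eq
  ... | inj₂ _ = contradiction xS λ ()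

  fromC : ∀ {x} → isC x ≡ true → Σ (Fin nH) λ h → nS ↑ʳ h ≡ x
  fromC {x} xC with splitAt nS x in eq
  ... | inj₁ _ = contradiction xC λ ()
  ... | inj₂ h = h , splitAt⁻¹-↑ʳ eq

  ad-sym : ∀ x y → ad x y ≡ ad y x
  ad-sym x y with splitAt nS x | splitAt nS y
  ... | inj₁ a | inj₁ b = Graph.sym (S T) a b
  ... | inj₂ c | inj₂ d = Graph.sym H c d
  ... | inj₁ _ | inj₂ _ = refl
  ... | inj₂ _ | inj₁ _ = refl

  adj-SS : ∀ a b → ad (a ↑ˡ nH) (b ↑ˡ nH) ≡ adj (S T) a b
  adj-SS a b rewrite splitAt-↑ˡ nS a nH | splitAt-↑ˡ nS b nH = refl

  adj-SC : ∀ a h → ad (a ↑ˡ nH) (nS ↑ʳ h) ≡ inA T a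
  adj-SC a h rewrite splitAt-↑ˡ nS a nH | splitAt-↑ʳ nS nH h = refl

  adj-CS : ∀ h a → ad (nS ↑ʳ h) (a ↑ˡ nH) ≡ inA T a
  adj-CS h a = trans (ad-sym (nS ↑ʳ h) (a ↑ˡ nH)) (adj-SC a h)

  C-isModule : IsModule ad (λ x → isC x ≡ true)
  C-isModule z zOut y₁ y₂ y₁C y₂C with fromS (¬-not zOut) | fromC y₁C | fromC y₂C
  ... | a , refl | h₁ , refl | h₂ , refl = trans (adj-SC a h₁) (sym (adj-SC a h₂))

  splitC : ∀ {z x y} → isC z ≡ false → isC x ≡ true → isC y ≡ true →
    ad z x ≡ true → ad z y ≡ false → ⊥
  splitC = moduleNotSplit isC C-isModule

  flip : ∀ {x y b} → ad x y ≡ b → ad y x ≡ b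
  flip = flipAdj ad-sym

  module _ (split : IsGeneralizedSplitTriad T) where

    -- An induced P₄ c-p-q-r with only the endpoint c in C: p is in A, the edge
    -- q-r lies in S[B], yet p is adjacent to q and not to r.
    endpointInC : ∀ {c p q r} → IsInducedP4 ad c p q r →
      isC c ≡ true → isC p ≡ false → isC q ≡ false → isC r ≡ false → ⊥
    endpointInC (_ , _ , _ , _ , _ , _ , cp , pq , qr , cq , pr , cr) cC pS qS rS
      with fromC cC | fromS pS | fromS qS | fromS rS
    ... | h , refl | a , refl | b , refl | d , refl =
      contradiction (trans (sym ab) (trans (B-edgeUnsplit T split bB dB bd aA) ad≡false)) λ ()
      where
      aA : inA T a ≡ true
      aA = trans (sym (adj-CS h a)) cp
      bB : inA T b ≡ false
      bB = trans (sym (adj-CS h b)) cq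
      dB : inA T d ≡ false
      dB = trans (sym (adj-CS h d)) cr
      ab : adj (S T) a b ≡ true
      ab = trans (sym (adj-SS a b)) pq
      bd : adj (S T) b d ≡ true
      bd = trans (sym (adj-SS b d)) qr
      ad≡false : adj (S T) a d ≡ false
      ad≡false = trans (sym (adj-SS a d)) pr

    -- An induced P₄ p-c-q-r with only the inner vertex c in C: the non-edge
    -- p-q lies in S[A] and r is in B, yet r is adjacent to q and not to p.
    innerInC : ∀ {p c q r} → IsInducedP4 ad p c q r →
      isC p ≡ false → isC c ≡ true → isC q ≡ false → isC r ≡ false → ⊥
    innerInC (_ , p≢q , _ , _ , _ , _ , pc , cq , qr , pq , cr , pr) pS cC qS rS
      with fromS pS | fromC cC | fromS qS | fromS rS
    ... | a , refl | h , refl | b , refl | d , refl =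
      contradiction (trans (sym da) (trans (A-nonEdgeUnsplit T split aA bA a≢b ab dB) db)) λ ()
      where
      aA : inA T a ≡ true
      aA = trans (sym (adj-SC a h)) pc
      bA : inA T b ≡ true
      bA = trans (sym (adj-CS h b)) cq
      dB : inA T d ≡ false
      dB = trans (sym (adj-CS h d)) cr
      a≢b : a ≢ b
      a≢b a≡b = p≢q (cong (_↑ˡ nH) a≡b)
      ab : adj (S T) a b ≡ false
      ab = trans (sym (adj-SS a b)) pq
      da : adj (S T) d a ≡ false
      da = trans (Graph.sym (S T) d a) (trans (sym (adj-SS a d)) pr)
      db : adj (S T) d b ≡ true
      db = trans (Graph.sym (S T) d b) (trans (sym (adj-SS b d)) qr)

    -- Two or three vertices in
    -- C would be split by a P₄-vertex outside the module C; a single vertex in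
    -- C is an endpoint or an inner vertex, excluded by the two lemmas above.
    noCrossingP4 : ∀ {p₁ p₂ p₃ p₄} → IsInducedP4 ad p₁ p₂ p₃ p₄ →
      (isC p₁ ≡ true ⊎ isC p₂ ≡ true ⊎ isC p₃ ≡ true ⊎ isC p₄ ≡ true) →
      (isC p₁ ≡ false ⊎ isC p₂ ≡ false ⊎ isC p₃ ≡ false ⊎ isC p₄ ≡ false) → ⊥
    noCrossingP4 {p₁} {p₂} {p₃} {p₄}
      P@(_ , _ , _ , _ , _ , _ , e₁₂ , e₂₃ , e₃₄ , n₁₃ , n₂₄ , n₁₄) someC someS
      with isC p₁ in k₁ | isC p₂ in k₂ | isC p₃ in k₃ | isC p₄ in k₄
    ... | true  | true  | true  | true  = noneDiffers someS
    ... | false | false | false | false = noneDiffers someC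
    ... | true  | false | false | false = endpointInC P k₁ k₂ k₃ k₄
    ... | false | false | false | true  = endpointInC (reverseP4 ad-sym P) k₄ k₃ k₂ k₁
    ... | false | true  | false | false = innerInC P k₁ k₂ k₃ k₄
    ... | false | false | true  | false = innerInC (reverseP4 ad-sym P) k₄ k₃ k₂ k₁
    ... | false | true  | true  | true  = splitC k₁ k₂ k₃ e₁₂ n₁₃
    ... | true  | false | true  | true  = splitC k₂ k₁ k₄ (flip e₁₂) n₂₄
    ... | true  | true  | false | true  = splitC k₃ k₄ k₁ e₃₄ (flip n₁₃)
    ... | true  | true  | true  | false = splitC k₄ k₃ k₂ (flip e₃₄) (flip n₂₄)
    ... | true  | true  | false | false = splitC k₃ k₂ k₁ (flip e₂₃) (flip n₁₃)
    ... | true  | false | true  | false = splitC k₄ k₃ k₁ (flip e₃₄) (flip n₁₄)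
    ... | true  | false | false | true  = splitC k₂ k₁ k₄ (flip e₁₂) n₂₄
    ... | false | true  | true  | false = splitC k₁ k₂ k₃ e₁₂ n₁₃
    ... | false | true  | false | true  = splitC k₁ k₂ k₄ e₁₂ n₁₄
    ... | false | false | true  | true  = splitC k₂ k₃ k₄ e₂₃ n₂₄

mainTheorem4 : (T : Triad) (H : Graph) → IsGeneralizedSplitTriad T →
    n H ≥ 1 → n (S T) ≥ 1 → P4Disconnected (composeAdj T H)
mainTheorem4 T H split nH≥1 nS≥1 p4Connected
  with p4Connected (isC T H) (n (S T) ↑ʳ fromℕ< nH≥1 , isC-↑ʳ T H _)
                             (fromℕ< nS≥1 ↑ˡ n H , isC-↑ˡ T H _)
... | _ , _ , _ , _ , P4 , someC , someS = noCrossingP4 T H split P4 someC someS
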